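{- A tree $T$ admits an odd caterpillar factor if and only if $|V(T)|$ is even and the following condition holds: for every vertex $v\in V(T)$, at most two of the B-neighbors of $v$ belong to odd components of $T-v$.
   Context: A caterpillar is a simple graph with at least one edge consisting of a path of order at least $1$ together with some (possibly zero) leaves adjacent to vertices of the path. A caterpillar is odd if every vertex of degree at least $2$ in it has odd degree; $K_2$ is an odd caterpillar. For a simple graph $G$, an odd caterpillar factor of $G$ is a set of subgraphs of $G$, each an odd caterpillar, such that each vertex of $G$ belongs to exactly one of them. A component is odd (even) if its number of vertices is odd (even). The oddness $o_G(v)$ of a vertex $v$ is the number of odd components of $G-v$. A vertex $v$ is an A-vertex if $o_G(v)=1$ and a B-vertex if $o_G(v)\ge 3$; a B-neighbor of $v$ is a neighbor of $v$ that is a B-vertex (here with respect to $G=T$). -}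

module Defs where

open import Data.Nat using (ℕ; zero; suc; _+_; _≤_; _%_)
open import Data.Fin using (Fin; zero; suc; inject₁; fromℕ)
open import Data.Bool using (Bool; true; false; if_then_else_)
open import Data.Product using (Σ; ∃; ∃-syntax; _×_; _,_)
open import Data.Sum using (_⊎_)
open import Data.Unit using (⊤)
open import Relation.Nullary using (¬_)
open import Relation.Binary.PropositionalEquality using (_≡_; _≢_)
open import Function using (_⇔_)
open import Function.Definitions using (Injective)

count : ∀ {n} → (Fin n → Bool) → ℕ
count {zero} p = 0
count {suc n} p = (if p zero then 1 else 0) + count (λ i → p (suc i))

Odd : ℕ → Set
Odd m = m % 2 ≡ 1

Even : ℕ → Set
Even m = m % 2 ≡ 0

record Graph (n : ℕ) : Set where
  field
    adj    : Fin n → Fin n → Bool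
    sym    : ∀ x y → adj x y ≡ adj y x
    irrefl : ∀ x → adj x x ≡ false
open Graph public

module _ {n : ℕ} (G : Graph n) where

  data Reach (P : Fin n → Set) (u : Fin n) : Fin n → Set where
    here : P u → Reach P u u
    step : ∀ {w x} → Reach P u w → adj G w x ≡ true → P x → Reach P u x

  Connected : Set
  Connected = ∀ u w → Reach (λ _ → ⊤) u w

  HasCycle : Set
  HasCycle = Σ ℕ λ k → Σ (Fin (suc (suc (suc k))) → Fin n) λ c →
      Injective _≡_ _≡_ c
    × (∀ (i : Fin (suc (suc k))) → adj G (c (inject₁ i)) (c (suc i)) ≡ true)
    × adj G (c (fromℕ (suc (suc k)))) (c zero) ≡ true

  IsTree : Set
  IsTree = (1 ≤ n) × Connected × ¬ HasCycle

  ReachMinus : Fin n → Fin n → Fin n → Set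
  ReachMinus v = Reach (λ x → x ≢ v)

  -- u lies in an odd component of G - v : the vertex set of the component of
  -- G - v containing u has odd size (this forces u ≢ v)
  InOddComponent : Fin n → Fin n → Set
  InOddComponent v u = Σ (Fin n → Bool) λ S →
      (∀ w → (S w ≡ true) ⇔ ReachMinus v u w) × Odd (count S)

  -- o_G(x) ≥ 3 : G - x has at least three (distinct) odd components
  IsBVertex : Fin n → Set
  IsBVertex x = ∃[ a ] ∃[ b ] ∃[ c ]
      InOddComponent x a × InOddComponent x b × InOddComponent x c
    × ¬ ReachMinus x a b × ¬ ReachMinus x a c × ¬ ReachMinus x b c

  Condition : Set
  Condition = ∀ v → ¬ (∃[ u₁ ] ∃[ u₂ ] ∃[ u₃ ]
      u₁ ≢ u₂ × u₁ ≢ u₃ × u₂ ≢ u₃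
    × (adj G v u₁ ≡ true × IsBVertex u₁ × InOddComponent v u₁)
    × (adj G v u₂ ≡ true × IsBVertex u₂ × InOddComponent v u₂)
    × (adj G v u₃ ≡ true × IsBVertex u₃ × InOddComponent v u₃))

  record Subgraph : Set where
    field
      vert     : Fin n → Bool
      edge     : Fin n → Fin n → Bool
      edge-sym : ∀ x y → edge x y ≡ edge y x
      edge-adj : ∀ x y → edge x y ≡ true → adj G x y ≡ true
      edge-vert : ∀ x y → edge x y ≡ true → vert x ≡ true
  open Subgraph public

  degree : Subgraph → Fin n → ℕ
  degree H x = count (edge H x)

  record IsCaterpillar (H : Subgraph) : Set where
    field
      k          : ℕ
      spine      : Fin (suc k) → Fin n
      spine-inj  : Injective _≡_ _≡_ spine
      spine-vert : ∀ i → vert H (spine i) ≡ true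
      path-edge  : ∀ (i : Fin k) → edge H (spine (inject₁ i)) (spine (suc i)) ≡ true
      edges-ok   : ∀ x y → edge H x y ≡ true →
          (∃[ i ] ((x ≡ spine (inject₁ i) × y ≡ spine (suc i))
                 ⊎ (y ≡ spine (inject₁ i) × x ≡ spine (suc i))))
        ⊎ ((∃[ i ] spine i ≡ x) × ¬ (∃[ i ] spine i ≡ y))
        ⊎ (¬ (∃[ i ] spine i ≡ x) × (∃[ i ] spine i ≡ y))
      leaves     : ∀ x → vert H x ≡ true → ¬ (∃[ i ] spine i ≡ x) →
          ∃[ y ] (edge H x y ≡ true × (∀ z → edge H x z ≡ true → z ≡ y))
      has-edge   : ∃[ x ] ∃[ y ] edge H x y ≡ true

  IsOddCaterpillar : Subgraph → Set
  IsOddCaterpillar H = IsCaterpillar H ×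
    (∀ x → vert H x ≡ true → 2 ≤ degree H x → Odd (degree H x))

  HasOddCaterpillarFactor : Set
  HasOddCaterpillarFactor = Σ ℕ λ m → Σ (Fin m → Subgraph) λ F →
      (∀ j → IsOddCaterpillar (F j))
    × (∀ v → ∃[ j ] (vert (F j) v ≡ true × (∀ j' → vert (F j') v ≡ true → j' ≡ j)))

module Submission where

-- Key fact (TreeParity.OddSubgraph.oddSubgraph-edge): if D ⊆ T has all degrees
-- odd, then vu ∈ D iff the component of T - v containing u is odd (handshake
-- lemma inside that component).
-- Necessity: the factor's edges form such a D; the handshake lemma makes n even,
-- B-vertices have two D-neighbours and so lie on spines, and three B-neighbours
-- of v in odd components would be three spine neighbours of the spine vertex v.
-- Sufficiency: D := {vu | component of T - v at u is odd} is symmetric with odd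
-- degrees as n is even; its non-leaves are B-vertices, so by the Condition each
-- vertex has at most two non-leaf D-neighbours and the non-leaves of a component
-- of D lie on one path, grown greedily from both ends: a caterpillar spine.

open import Defs hiding (sym)
open import Data.Nat using (ℕ; zero; suc; _+_; _∸_; _≤_; _<_; z≤n; s≤s; _≤?_)
open import Data.Nat.Properties
  using (+-suc; +-comm; ≤-refl; ≤-trans; ≤-antisym; ≤-pred; ≰⇒>; n≤1+n; m≤n⇒m≤1+n; m≤n+m; m≤n⇒m<n∨m≡n
        ; m∸n≤m; m∸n+n≡m; m+[n∸m]≡n; n∸n≡0; +-∸-assoc; ∸-cancelˡ-≡; +-cancelˡ-≡; +-cancelʳ-≡; +-monoˡ-≤; +-monoʳ-≤
        ; +-identityʳ; <-cmp; suc-injective; +-0-commutativeMonoid)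
open import Data.Fin using (Fin; zero; suc; toℕ; inject₁; fromℕ; fromℕ<)
open import Data.Fin.Properties
  using (_≟_; any?; toℕ-injective; toℕ-inject₁; toℕ-fromℕ; toℕ-fromℕ<; toℕ≤pred[n]; injective⇒≤)
  renaming (suc-injective to fsuc-injective)
open import Data.Bool using (Bool; true; false; not; _∧_; _∨_; _xor_; if_then_else_)
open import Data.Bool.Properties using (∧-zeroʳ; ∧-identityʳ; xor-same; xor-identityʳ; not-involutive; not-distribˡ-xor)
open import Data.Product using (Σ; ∃-syntax; _×_; _,_; proj₁; proj₂)
open import Data.Sum using (_⊎_; inj₁; inj₂)
open import Data.Empty using (⊥; ⊥-elim)
open import Data.Unit using (⊤)
open import Data.Maybe using (Maybe; just; nothing; fromMaybe)
open import Data.Maybe.Properties using (just-injective)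
open import Relation.Nullary using (¬_; Dec; yes; no)
open import Relation.Binary using (tri<; tri≈; tri>)
open import Relation.Binary.PropositionalEquality
open import Function using (_⇔_; mk⇔; Equivalence; _∘_)
open import Algebra.Properties.CommutativeMonoid.Sum +-0-commutativeMonoid
  using (sum; ∑-distrib-+; ∑-comm; sum-cong-≗)

boolCase : (b : Bool) → b ≡ true ⊎ b ≡ false
boolCase true = inj₁ refl
boolCase false = inj₂ refl

false≢true : false ≢ true
false≢true ()

bool-ext : ∀ {b c : Bool} → (b ≡ true → c ≡ true) → (c ≡ true → b ≡ true) → b ≡ c
bool-ext {true} f g = sym (f refl)
bool-ext {false} {true} f g = g refl
bool-ext {false} {false} f g = refl

∧-true₁ : ∀ {b c} → (b ∧ c) ≡ true → b ≡ true
∧-true₁ {true} e = refl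

∧-true₂ : ∀ {b c} → (b ∧ c) ≡ true → c ≡ true
∧-true₂ {true} e = e

∧-not : ∀ {b c} → b ≡ true → c ≡ false → (b ∧ not c) ≡ true
∧-not refl refl = refl

∨-introˡ : ∀ {b c} → b ≡ true → (b ∨ c) ≡ true
∨-introˡ refl = refl

∨-elim : ∀ {b c} → (b ∨ c) ≡ true → b ≡ true ⊎ c ≡ true
∨-elim {true} e = inj₁ refl
∨-elim {false} e = inj₂ e

not-true : ∀ {b} → not b ≡ true → b ≡ false
not-true {false} e = refl

_==_ : ∀ {n} → Fin n → Fin n → Bool
i == j with i ≟ j
... | yes _ = true
... | no _ = false

==-refl : ∀ {n} (i : Fin n) → (i == i) ≡ true
==-refl i with i ≟ i
... | yes _ = refl
... | no ne = ⊥-elim (ne refl)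

==-true : ∀ {n} {i j : Fin n} → (i == j) ≡ true → i ≡ j
==-true {i = i} {j} e with i ≟ j
... | yes q = q

==-false : ∀ {n} {i j : Fin n} → i ≢ j → (i == j) ≡ false
==-false {i = i} {j} ne with i ≟ j
... | yes q = ⊥-elim (ne q)
... | no _ = refl

==-suc : ∀ {n} (i j : Fin n) → (suc i == suc j) ≡ (i == j)
==-suc i j with i ≟ j | suc i ≟ suc j
... | yes _ | yes _ = refl
... | no _ | no _ = refl
... | yes q | no ne = ⊥-elim (ne (cong suc q))
... | no ne | yes q = ⊥-elim (ne (fsuc-injective q))

_without_ : ∀ {n} → (Fin n → Bool) → Fin n → Fin n → Bool
(p without j) i = p i ∧ not (i == j)

without-≢ : ∀ {n} (p : Fin n → Bool) {i j} → (p without j) i ≡ true → i ≢ j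
without-≢ p {i} e refl rewrite ==-refl i = false≢true (∧-true₂ {p i} e)

without-⊆ : ∀ {n} (p : Fin n → Bool) {i j} → (p without j) i ≡ true → p i ≡ true
without-⊆ p e = ∧-true₁ e

without-∈ : ∀ {n} (p : Fin n → Bool) {i j} → p i ≡ true → i ≢ j → (p without j) i ≡ true
without-∈ p pi ne = ∧-not pi (==-false ne)

ind : Bool → ℕ
ind b = if b then 1 else 0

count≡sum : ∀ {n} (p : Fin n → Bool) → count p ≡ sum (ind ∘ p)
count≡sum {zero} p = refl
count≡sum {suc n} p = cong (ind (p zero) +_) (count≡sum (p ∘ suc))

count-cong : ∀ {n} {p q : Fin n → Bool} → (∀ i → p i ≡ q i) → count p ≡ count q
count-cong {zero} e = refl
count-cong {suc n} e = cong₂ _+_ (cong ind (e zero)) (count-cong (e ∘ suc))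

count-≤ : ∀ {n} (p : Fin n → Bool) → count p ≤ n
count-≤ {zero} p = z≤n
count-≤ {suc n} p with p zero
... | true = s≤s (count-≤ (p ∘ suc))
... | false = m≤n⇒m≤1+n (count-≤ (p ∘ suc))

count-zero : ∀ {n} (p : Fin n → Bool) → (∀ i → p i ≡ false) → count p ≡ 0
count-zero {zero} p h = refl
count-zero {suc n} p h rewrite h zero = count-zero (p ∘ suc) (h ∘ suc)

count-strict : ∀ {n} {p q : Fin n → Bool} → (∀ i → p i ≡ true → q i ≡ true) →
  ∀ j → p j ≡ false → q j ≡ true → suc (count p) ≤ count q
count-strict {suc n} {p} {q} h zero pj qj rewrite pj | qj = s≤s (mono (h ∘ suc))
  where
  mono : ∀ {m} {p q : Fin m → Bool} → (∀ i → p i ≡ true → q i ≡ true) → count p ≤ count q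
  mono {zero} h = z≤n
  mono {suc m} {p} {q} h with p zero in e1 | q zero in e2
  ... | true | true = s≤s (mono (h ∘ suc))
  ... | true | false = ⊥-elim (false≢true (trans (sym e2) (h zero e1)))
  ... | false | true = m≤n⇒m≤1+n (mono (h ∘ suc))
  ... | false | false = mono (h ∘ suc)
count-strict {suc n} {p} {q} h (suc j) pj qj with p zero in e1 | q zero in e2
... | true | true = s≤s (count-strict (h ∘ suc) j pj qj)
... | true | false = ⊥-elim (false≢true (trans (sym e2) (h zero e1)))
... | false | true = m≤n⇒m≤1+n (count-strict (h ∘ suc) j pj qj)
... | false | false = count-strict (h ∘ suc) j pj qj

count-pos : ∀ {n} (p : Fin n → Bool) j → p j ≡ true → 1 ≤ count p
count-pos {suc n} p zero pj rewrite pj = s≤s z≤n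
count-pos {suc n} p (suc j) pj with p zero
... | true = s≤s z≤n
... | false = count-pos (p ∘ suc) j pj

count-find : ∀ {n} (p : Fin n → Bool) → 1 ≤ count p → ∃[ i ] p i ≡ true
count-find {suc n} p h with p zero in e
... | true = zero , e
... | false with count-find (p ∘ suc) h
... | i , q = suc i , q

count-remove : ∀ {n} (p : Fin n → Bool) j → p j ≡ true → count p ≡ suc (count (p without j))
count-remove {suc n} p zero pj rewrite pj | ==-refl {suc n} zero =
  cong suc (count-cong λ i → sym (∧-identityʳ (p (suc i))))
count-remove {suc n} p (suc j) pj with p zero
... | true = cong suc (trans (count-remove (p ∘ suc) j pj) (cong suc (count-cong λ i → cong (λ b → p (suc i) ∧ not b) (sym (==-suc i j)))))
... | false = trans (count-remove (p ∘ suc) j pj) (cong suc (count-cong λ i → cong (λ b → p (suc i) ∧ not b) (sym (==-suc i j))))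

count-single : ∀ {n} (p : Fin n → Bool) j → p j ≡ true → (∀ i → p i ≡ true → i ≡ j) → count p ≡ 1
count-single p j pj h = trans (count-remove p j pj) (cong suc (count-zero _ none))
  where
  none : ∀ i → (p without j) i ≡ false
  none i with boolCase ((p without j) i)
  ... | inj₂ f = f
  ... | inj₁ t = ⊥-elim (without-≢ p t (h i (without-⊆ p t)))

count-two : ∀ {n} (p : Fin n → Bool) i j → p i ≡ true → p j ≡ true → i ≢ j → 2 ≤ count p
count-two p i j pi pj ne rewrite count-remove p i pi = s≤s (count-pos (p without i) j (without-∈ p pj (ne ∘ sym)))

count-find2 : ∀ {n} (p : Fin n → Bool) → 2 ≤ count p → ∃[ i ] ∃[ j ] (p i ≡ true × p j ≡ true × i ≢ j)
count-find2 p h with count-find p (≤-trans (s≤s z≤n) h)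
... | i , pi with count-find (p without i) (≤-pred (subst (2 ≤_) (count-remove p i pi) h))
... | j , pj = i , j , pi , without-⊆ p pj , λ e → without-≢ p pj (sym e)

count-find3 : ∀ {n} (p : Fin n → Bool) → 3 ≤ count p →
  ∃[ i ] ∃[ j ] ∃[ l ] (p i ≡ true × p j ≡ true × p l ≡ true × i ≢ j × i ≢ l × j ≢ l)
count-find3 p h with count-find p (≤-trans (s≤s z≤n) h)
... | i , pi with count-find2 (p without i) (≤-pred (subst (3 ≤_) (count-remove p i pi) h))
... | j , l , pj , pl , jl =
  i , j , l , pi , without-⊆ p pj , without-⊆ p pl , (λ e → without-≢ p pj (sym e)) , (λ e → without-≢ p pl (sym e)) , jl

count-partition : ∀ {n} (p q : Fin n → Bool) → (∀ i → q i ≡ not (p i)) → count p + count q ≡ n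
count-partition {zero} p q h = refl
count-partition {suc n} p q h rewrite h zero with p zero
... | true = cong suc (count-partition (p ∘ suc) (q ∘ suc) (h ∘ suc))
... | false = trans (+-suc (count (p ∘ suc)) (count (q ∘ suc))) (cong suc (count-partition (p ∘ suc) (q ∘ suc) (h ∘ suc)))

count-split : ∀ {n} (p q : Fin n → Bool) → count p ≡ count (λ i → p i ∧ q i) + count (λ i → p i ∧ not (q i))
count-split {zero} p q = refl
count-split {suc n} p q with p zero | q zero
... | true | true = cong suc (count-split (p ∘ suc) (q ∘ suc))
... | true | false = trans (cong suc (count-split (p ∘ suc) (q ∘ suc))) (sym (+-suc _ _))
... | false | _ = count-split (p ∘ suc) (q ∘ suc)

sum-single : ∀ {n} (f : Fin n → ℕ) u → (∀ x → x ≢ u → f x ≡ 0) → sum f ≡ f u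
sum-single {suc n} f zero h = trans (cong (f zero +_) (sum-zero (f ∘ suc) λ i → h (suc i) λ ())) (+-identityʳ (f zero))
  where
  sum-zero : ∀ {m} (g : Fin m → ℕ) → (∀ i → g i ≡ 0) → sum g ≡ 0
  sum-zero {zero} g z = refl
  sum-zero {suc m} g z rewrite z zero = sum-zero (g ∘ suc) (z ∘ suc)
sum-single {suc n} f (suc u) h =
  trans (cong (_+ sum (f ∘ suc)) (h zero λ ())) (sum-single (f ∘ suc) u λ x ne → h (suc x) (ne ∘ fsuc-injective))

sum-ones : ∀ n → sum {n} (λ _ → 1) ≡ n
sum-ones zero = refl
sum-ones (suc n) = cong suc (sum-ones n)

parity : ℕ → Bool
parity zero = false
parity (suc m) = not (parity m)

parity-+ : ∀ a b → parity (a + b) ≡ parity a xor parity b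
parity-+ zero b = refl
parity-+ (suc a) b rewrite parity-+ a b = not-distribˡ-xor (parity a) (parity b)

Odd⇒parity : ∀ m → Odd m → parity m ≡ true
Odd⇒parity (suc zero) e = refl
Odd⇒parity (suc (suc m)) e rewrite Odd⇒parity m e = refl

parity⇒Odd : ∀ m → parity m ≡ true → Odd m
parity⇒Odd (suc zero) e = refl
parity⇒Odd (suc (suc m)) e = parity⇒Odd m (trans (sym (not-involutive (parity m))) e)

Even⇒parity : ∀ m → Even m → parity m ≡ false
Even⇒parity zero e = refl
Even⇒parity (suc (suc m)) e rewrite Even⇒parity m e = refl

parity⇒Even : ∀ m → parity m ≡ false → Even m
parity⇒Even zero e = refl
parity⇒Even (suc zero) ()
parity⇒Even (suc (suc m)) e = parity⇒Even m (trans (sym (not-involutive (parity m))) e)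

parity-ind : ∀ b → parity (ind b) ≡ b
parity-ind true = refl
parity-ind false = refl

parity-sum-cong : ∀ {n} (f g : Fin n → ℕ) → (∀ i → parity (f i) ≡ parity (g i)) → parity (sum f) ≡ parity (sum g)
parity-sum-cong {zero} f g e = refl
parity-sum-cong {suc n} f g e =
  trans (parity-+ (f zero) (sum (f ∘ suc)))
    (trans (cong₂ _xor_ (e zero) (parity-sum-cong (f ∘ suc) (g ∘ suc) (e ∘ suc))) (sym (parity-+ (g zero) (sum (g ∘ suc)))))

handshake : ∀ {n} (M : Fin n → Fin n → Bool) → (∀ x y → M x y ≡ M y x) → (∀ x → M x x ≡ false) →
  parity (sum (λ x → count (M x))) ≡ false
handshake {zero} M M-sym M-irr = refl
handshake {suc n} M M-sym M-irr =
  begin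
    parity (count (M zero) + sum (λ x → count (M (suc x))))
  ≡⟨ cong (λ b → parity (ind b + c + sum (λ x → count (M (suc x))))) (M-irr zero) ⟩
    parity (c + sum (λ x → ind (M (suc x) zero) + count (λ y → M (suc x) (suc y))))
  ≡⟨ cong (λ z → parity (c + z)) (∑-distrib-+ (λ x → ind (M (suc x) zero)) (λ x → count (λ y → M (suc x) (suc y)))) ⟩
    parity (c + (sum (λ x → ind (M (suc x) zero)) + rest))
  ≡⟨ cong (λ z → parity (c + (z + rest))) (sym (count≡sum (λ x → M (suc x) zero))) ⟩
    parity (c + (count (λ x → M (suc x) zero) + rest))
  ≡⟨ cong (λ z → parity (c + (z + rest))) (count-cong (λ x → M-sym (suc x) zero)) ⟩
    parity (c + (c + rest))
  ≡⟨ trans (parity-+ c (c + rest)) (cong (parity c xor_) (parity-+ c rest)) ⟩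
    parity c xor (parity c xor parity rest)
  ≡⟨ cong (λ b → parity c xor (parity c xor b)) (handshake (λ x y → M (suc x) (suc y)) (λ x y → M-sym (suc x) (suc y)) (M-irr ∘ suc)) ⟩
    parity c xor (parity c xor false)
  ≡⟨ trans (cong (parity c xor_) (xor-identityʳ (parity c))) (xor-same (parity c)) ⟩
    false
  ∎
  where
  open ≡-Reasoning
  c rest : ℕ
  c = count (λ y → M zero (suc y))
  rest = sum (λ x → count (λ y → M (suc x) (suc y)))

anyF : ∀ {n} → (Fin n → Bool) → Bool
anyF {zero} p = false
anyF {suc n} p = p zero ∨ anyF (p ∘ suc)

anyF-intro : ∀ {n} (p : Fin n → Bool) i → p i ≡ true → anyF p ≡ true
anyF-intro p zero e rewrite e = refl
anyF-intro p (suc i) e rewrite anyF-intro (p ∘ suc) i e with p zero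
... | true = refl
... | false = refl

anyF-elim : ∀ {n} (p : Fin n → Bool) → anyF p ≡ true → ∃[ i ] p i ≡ true
anyF-elim {suc n} p e with p zero in q
... | true = zero , q
... | false with anyF-elim (p ∘ suc) e
... | i , r = suc i , r

anyF-cong : ∀ {n} {p q : Fin n → Bool} → (∀ i → p i ≡ q i) → anyF p ≡ anyF q
anyF-cong {zero} e = refl
anyF-cong {suc n} e = cong₂ _∨_ (e zero) (anyF-cong (e ∘ suc))

mutual
  enumerate : ∀ {n} (p : Fin n → Bool) → Fin (count p) → Fin n
  enumerate {zero} p ()
  enumerate {suc n} p j = enumerate′ p (p zero) j

  -- enumeration with the head value p zero exposed, so that count unfolds
  enumerate′ : ∀ {n} (p : Fin (suc n) → Bool) (b : Bool) → Fin (ind b + count (p ∘ suc)) → Fin (suc n)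
  enumerate′ p true zero = zero
  enumerate′ p true (suc j) = suc (enumerate (p ∘ suc) j)
  enumerate′ p false j = suc (enumerate (p ∘ suc) j)

mutual
  enumerate-sound : ∀ {n} (p : Fin n → Bool) j → p (enumerate p j) ≡ true
  enumerate-sound {suc n} p j = enumerate′-sound p (p zero) refl j

  enumerate′-sound : ∀ {n} (p : Fin (suc n) → Bool) b → p zero ≡ b → ∀ j → p (enumerate′ p b j) ≡ true
  enumerate′-sound p true e zero = e
  enumerate′-sound p true e (suc j) = enumerate-sound (p ∘ suc) j
  enumerate′-sound p false e j = enumerate-sound (p ∘ suc) j

mutual
  enumerate-injective : ∀ {n} (p : Fin n → Bool) j j' → enumerate p j ≡ enumerate p j' → j ≡ j'
  enumerate-injective {suc n} p j j' e = enumerate′-injective p (p zero) j j' e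

  enumerate′-injective : ∀ {n} (p : Fin (suc n) → Bool) b j j' → enumerate′ p b j ≡ enumerate′ p b j' → j ≡ j'
  enumerate′-injective p true zero zero e = refl
  enumerate′-injective p true zero (suc j') ()
  enumerate′-injective p true (suc j) zero ()
  enumerate′-injective p true (suc j) (suc j') e = cong suc (enumerate-injective (p ∘ suc) j j' (fsuc-injective e))
  enumerate′-injective p false j j' e = enumerate-injective (p ∘ suc) j j' (fsuc-injective e)

mutual
  enumerate-complete : ∀ {n} (p : Fin n → Bool) x → p x ≡ true → ∃[ j ] enumerate p j ≡ x
  enumerate-complete {suc n} p x px = enumerate′-complete p (p zero) refl x px

  enumerate′-complete : ∀ {n} (p : Fin (suc n) → Bool) b → p zero ≡ b → ∀ x → p x ≡ true → ∃[ j ] enumerate′ p b j ≡ x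
  enumerate′-complete p true e zero px = zero , refl
  enumerate′-complete p false e zero px = ⊥-elim (false≢true (trans (sym e) px))
  enumerate′-complete p true e (suc x) px with enumerate-complete (p ∘ suc) x px
  ... | j , q = suc j , cong suc q
  enumerate′-complete p false e (suc x) px with enumerate-complete (p ∘ suc) x px
  ... | j , q = j , cong suc q

first : ∀ {n} → (Fin n → Bool) → Maybe (Fin n)
first {zero} p = nothing
first {suc n} p = if p zero then just zero else Data.Maybe.map suc (first (p ∘ suc))

first-cong : ∀ {n} {p q : Fin n → Bool} → (∀ i → p i ≡ q i) → first p ≡ first q
first-cong {zero} e = refl
first-cong {suc n} {p} {q} e rewrite e zero | first-cong {p = p ∘ suc} {q = q ∘ suc} (e ∘ suc) = refl

first-sound : ∀ {n} (p : Fin n → Bool) i → first p ≡ just i → p i ≡ true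
first-sound {suc n} p i e with p zero in q
first-sound {suc n} p .zero refl | true = q
... | false with first (p ∘ suc) in q₂
first-sound {suc n} p .(suc j) refl | false | just j = first-sound (p ∘ suc) j q₂

first-complete : ∀ {n} (p : Fin n → Bool) i → p i ≡ true → first p ≢ nothing
first-complete {suc n} p i pi e with p zero in q
first-complete {suc n} p i pi () | true
... | false with first (p ∘ suc) in q₂
first-complete {suc n} p zero pi e | false | nothing = false≢true (trans (sym q) pi)
first-complete {suc n} p (suc i) pi e | false | nothing = first-complete (p ∘ suc) i pi q₂
first-complete {suc n} p i pi () | false | just j

module Walks {n : ℕ} (G : Graph n) where

  reach-end : ∀ {P u w} → Reach G P u w → P w
  reach-end (here p) = p
  reach-end (step r e p) = p

  reach-start : ∀ {P u w} → Reach G P u w → P u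
  reach-start (here p) = p
  reach-start (step r e p) = reach-start r

  reach-trans : ∀ {P u w x} → Reach G P u w → Reach G P w x → Reach G P u x
  reach-trans r (here _) = r
  reach-trans r (step r' e p) = step (reach-trans r r') e p

  reach-sym : ∀ {P u w} → Reach G P u w → Reach G P w u
  reach-sym (here p) = here p
  reach-sym (step {w'} {x} r e p) =
    reach-trans (step (here p) (trans (Graph.sym G x w') e) (reach-end r)) (reach-sym r)

  reach-mono : ∀ {P Q : Fin n → Set} → (∀ x → P x → Q x) → ∀ {u w} → Reach G P u w → Reach G Q u w
  reach-mono f (here p) = here (f _ p)
  reach-mono f (step r e p) = step (reach-mono f r) e (f _ p)

  reach-exit : ∀ {P v w} → Reach G P v w → w ≢ v →
    ∃[ x ] (adj G v x ≡ true × Reach G (λ z → P z × z ≢ v) x w)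
  reach-exit (here p) ne = ⊥-elim (ne refl)
  reach-exit {P} {v} (step {w'} {x} r e p) ne with w' ≟ v
  ... | yes refl = x , e , here (p , ne)
  ... | no ne' with reach-exit r ne'
  ... | y , a , r' = y , a , step r' e (p , ne)

  -- Reachability from u inside the vertex set pb is decidable: the set of
  -- vertices reached by walks with at most k steps grows strictly until it is
  -- closed, so after n + 1 rounds it is the whole reachable set.
  module Closure (pb : Fin n → Bool) (u : Fin n) where

    Pb : Fin n → Set
    Pb x = pb x ≡ true

    expand : (Fin n → Bool) → Fin n → Bool
    expand R x = R x ∨ (pb x ∧ anyF (λ y → R y ∧ adj G y x))

    within : ℕ → Fin n → Bool
    within zero x = (x == u) ∧ pb u
    within (suc k) = expand (within k)

    within-sound : ∀ k x → within k x ≡ true → Reach G Pb u x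
    within-sound zero x e with ==-true {i = x} {u} (∧-true₁ e)
    ... | refl = here (∧-true₂ e)
    within-sound (suc k) x e with ∨-elim e
    ... | inj₁ e' = within-sound k x e'
    ... | inj₂ e' with anyF-elim _ (∧-true₂ e')
    ... | y , q = step (within-sound k y (∧-true₁ q)) (∧-true₂ q) (∧-true₁ e')

    within-suc : ∀ k x → within k x ≡ true → within (suc k) x ≡ true
    within-suc k x = ∨-introˡ

    within-+ : ∀ k d x → within k x ≡ true → within (d + k) x ≡ true
    within-+ k zero x e = e
    within-+ k (suc d) x e = within-suc (d + k) x (within-+ k d x e)

    Closed : ℕ → Set
    Closed k = ∀ x → within (suc k) x ≡ true → within k x ≡ true

    closed-suc : ∀ k → Closed k → Closed (suc k)
    closed-suc k c x e = subst (_≡ true) (expand-cong (λ y → bool-ext (c y) (within-suc k y)) x) e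
      where
      expand-cong : ∀ {R R'} → (∀ x → R x ≡ R' x) → ∀ x → expand R x ≡ expand R' x
      expand-cong e x = cong₂ _∨_ (e x) (cong (pb x ∧_) (anyF-cong (λ y → cong (_∧ adj G y x) (e y))))

    closed-or-new : ∀ k → Closed k ⊎ ∃[ x ] (within (suc k) x ≡ true × within k x ≡ false)
    closed-or-new k with anyF (λ x → within (suc k) x ∧ not (within k x)) in e
    ... | true with anyF-elim _ e
    ... | x , q = inj₂ (x , ∧-true₁ q , not-true (∧-true₂ q))
    closed-or-new k | false = inj₁ closed
      where
      closed : Closed k
      closed x e' with boolCase (within k x)
      ... | inj₁ t = t
      ... | inj₂ f = ⊥-elim (false≢true (trans (sym e) (anyF-intro _ x (∧-not e' f))))

    grows : ∀ k → k ≤ count (within k) ⊎ Closed k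
    grows zero = inj₁ z≤n
    grows (suc k) with grows k
    ... | inj₂ c = inj₂ (closed-suc k c)
    ... | inj₁ le with closed-or-new k
    ... | inj₁ c = inj₂ (closed-suc k c)
    ... | inj₂ (x , a , b) = inj₁ (≤-trans (s≤s le) (count-strict (within-suc k) x b a))

    closed : Closed (suc n)
    closed with grows (suc n)
    ... | inj₂ c = c
    ... | inj₁ le = ⊥-elim (absurd (≤-trans le (count-≤ (within (suc n)))))
      where
      absurd : ∀ {m} → suc m ≤ m → ⊥
      absurd {suc m} (s≤s h) = absurd h

    reachable : Fin n → Bool
    reachable = within (suc n)

    reachable-sound : ∀ x → reachable x ≡ true → Reach G Pb u x
    reachable-sound = within-sound (suc n)

    reachable-complete : ∀ x → Reach G Pb u x → reachable x ≡ true
    reachable-complete x (here p) = subst (λ k → within k u ≡ true) (+-identityʳ (suc n))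
      (within-+ 0 (suc n) u (subst (λ b → (b ∧ pb u) ≡ true) (sym (==-refl u)) p))
    reachable-complete x (step {w} r e p) = closed x (expands (reachable-complete w r))
      where
      expands : reachable w ≡ true → expand reachable x ≡ true
      expands rw with reachable x
      ... | true = refl
      ... | false = subst (λ b → (b ∧ anyF (λ y → reachable y ∧ adj G y x)) ≡ true) (sym p)
                      (anyF-intro (λ y → reachable y ∧ adj G y x) w (subst (λ b → (b ∧ adj G w x) ≡ true) (sym rw) e))

∸-suc : ∀ l i → i < l → l ∸ i ≡ suc (l ∸ suc i)
∸-suc (suc l) zero _ = refl
∸-suc (suc l) (suc i) (s≤s lt) = ∸-suc l i lt

∸-∸ : ∀ l i → i ≤ l → l ∸ (l ∸ i) ≡ i
∸-∸ l zero _ rewrite n∸n≡0 l = refl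
∸-∸ (suc l) (suc i) (s≤s le) = trans (+-∸-assoc 1 (m∸n≤m l i)) (cong suc (∸-∸ l i le))

findIndex : ∀ {n} (g : ℕ → Fin n) (x : Fin n) (l : ℕ) → (∃[ j ] (j ≤ l × g j ≡ x)) ⊎ (∀ j → j ≤ l → g j ≢ x)
findIndex g x zero with g zero ≟ x
... | yes e = inj₁ (zero , z≤n , e)
... | no ne = inj₂ λ { zero z≤n → ne }
findIndex g x (suc l) with findIndex g x l
... | inj₁ (j , le , e) = inj₁ (j , ≤-trans le (n≤1+n l) , e)
... | inj₂ f with g (suc l) ≟ x
... | yes e = inj₁ (suc l , ≤-refl , e)
... | no ne = inj₂ absent
  where
  absent : ∀ j → j ≤ suc l → g j ≢ x
  absent j le with m≤n⇒m<n∨m≡n le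
  ... | inj₁ lt = f j (≤-pred lt)
  ... | inj₂ refl = ne

module Paths {n : ℕ} (A : Fin n → Fin n → Bool) where

  record Path : Set where
    field
      len  : ℕ
      at   : ℕ → Fin n
      inj  : ∀ i j → i ≤ len → j ≤ len → at i ≡ at j → i ≡ j
      link : ∀ i → i < len → A (at i) (at (suc i)) ≡ true
  open Path public

  _∈P_ : Fin n → Path → Set
  y ∈P P = ∃[ i ] (i ≤ len P × at P i ≡ y)

  _∈P?_ : ∀ y P → y ∈P P ⊎ ¬ y ∈P P
  y ∈P? P with findIndex (at P) y (len P)
  ... | inj₁ m = inj₁ m
  ... | inj₂ f = inj₂ (λ { (i , le , e) → f i le e })

  length-bound : ∀ (P : Path) → suc (len P) ≤ n
  length-bound P = injective⇒≤ {f = λ (i : Fin (suc (len P))) → at P (toℕ i)}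
    (λ {a} {b} e → toℕ-injective (inj P (toℕ a) (toℕ b) (toℕ≤pred[n] a) (toℕ≤pred[n] b) e))

  single : Fin n → Path
  single s = record { len = 0 ; at = λ _ → s ; inj = λ { zero zero _ _ _ → refl } ; link = λ i () }

  cons : (P : Path) (y : Fin n) → A y (at P 0) ≡ true → ¬ y ∈P P → Path
  cons P y e notin = record { len = suc (len P) ; at = at' ; inj = inj' ; link = link' }
    where
    at' : ℕ → Fin n
    at' zero = y
    at' (suc i) = at P i
    inj' : ∀ i j → i ≤ suc (len P) → j ≤ suc (len P) → at' i ≡ at' j → i ≡ j
    inj' zero zero _ _ _ = refl
    inj' zero (suc j) _ (s≤s b) eq = ⊥-elim (notin (j , b , sym eq))
    inj' (suc i) zero (s≤s a) _ eq = ⊥-elim (notin (i , a , eq))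
    inj' (suc i) (suc j) (s≤s a) (s≤s b) eq = cong suc (inj P i j a b eq)
    link' : ∀ i → i < suc (len P) → A (at' i) (at' (suc i)) ≡ true
    link' zero _ = e
    link' (suc i) (s≤s lt) = link P i lt

  cons-⊇ : ∀ P y e ni x → x ∈P P → x ∈P cons P y e ni
  cons-⊇ P y e ni x (i , le , eq) = suc i , s≤s le , eq

  module _ (A-sym : ∀ x y → A x y ≡ A y x) where

    reverse : Path → Path
    reverse P = record { len = len P ; at = λ i → at P (len P ∸ i) ; inj = inj' ; link = link' }
      where
      inj' : ∀ i j → i ≤ len P → j ≤ len P → at P (len P ∸ i) ≡ at P (len P ∸ j) → i ≡ j
      inj' i j a b eq = ∸-cancelˡ-≡ a b (inj P _ _ (m∸n≤m (len P) i) (m∸n≤m (len P) j) eq)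
      link' : ∀ i → i < len P → A (at P (len P ∸ i)) (at P (len P ∸ suc i)) ≡ true
      link' i lt rewrite ∸-suc (len P) i lt =
        trans (A-sym (at P (suc (len P ∸ suc i))) (at P (len P ∸ suc i))) (link P (len P ∸ suc i) (below (len P) i lt))
        where
        below : ∀ l i → i < l → l ∸ suc i < l
        below (suc l) i _ = s≤s (m∸n≤m l i)

    reverse-⊇ : ∀ P x → x ∈P P → x ∈P reverse P
    reverse-⊇ P x (i , le , eq) = len P ∸ i , m∸n≤m (len P) i , trans (cong (at P) (∸-∸ (len P) i le)) eq

module Cycles {n : ℕ} (G : Graph n) where
  open Paths (adj G)

  path⇒cycle : (P : Path) → 2 ≤ len P → adj G (at P (len P)) (at P 0) ≡ true → HasCycle G
  path⇒cycle P le e = go (len P) refl le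
    where
    go : ∀ m → len P ≡ m → 2 ≤ m → HasCycle G
    go (suc zero) _ (s≤s ())
    go (suc (suc k)) eq _ = k , (λ f → at P (toℕ f)) , injective , consecutive , closing
      where
      injective : ∀ {a b : Fin (suc (suc (suc k)))} → at P (toℕ a) ≡ at P (toℕ b) → a ≡ b
      injective {a} {b} e' = toℕ-injective (inj P (toℕ a) (toℕ b)
        (subst (toℕ a ≤_) (sym eq) (toℕ≤pred[n] a)) (subst (toℕ b ≤_) (sym eq) (toℕ≤pred[n] b)) e')
      consecutive : ∀ (i : Fin (suc (suc k))) → adj G (at P (toℕ (inject₁ i))) (at P (suc (toℕ i))) ≡ true
      consecutive i rewrite toℕ-inject₁ i = link P (toℕ i) (subst (suc (toℕ i) ≤_) (sym eq) (s≤s (toℕ≤pred[n] i)))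
      closing : adj G (at P (toℕ (fromℕ (suc (suc k))))) (at P 0) ≡ true
      closing rewrite toℕ-fromℕ (suc (suc k)) = subst (λ z → adj G (at P z) (at P 0) ≡ true) eq e

  record PathAvoiding (v u x : Fin n) : Set where
    field
      path   : Path
      starts : at path 0 ≡ x
      ends   : at path (len path) ≡ u
      avoids : ∀ i → i ≤ len path → at path i ≢ v
  open PathAvoiding

  walk⇒path : ∀ {v u x} → ReachMinus G v u x → PathAvoiding v u x
  walk⇒path {v} {u} {.u} (here p) = record { path = single u ; starts = refl ; ends = refl ; avoids = λ _ _ → p }
  walk⇒path {v} {u} {x} (step {w} r e px) with walk⇒path r
  ... | S with findIndex (at (path S)) x (len (path S))
  ... | inj₁ (j , jle , gj) = record
    { path = record { len = L ∸ j ; at = λ i → g (i + j)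
                    ; inj = λ i i' a b eq → +-cancelʳ-≡ j i i' (inj (path S) (i + j) (i' + j) (bound i a) (bound i' b) eq)
                    ; link = λ i lt → link (path S) (i + j) (bound (suc i) lt) }
    ; starts = gj
    ; ends = trans (cong g (m∸n+n≡m jle)) (ends S)
    ; avoids = λ i le → avoids S (i + j) (bound i le) }
    where
    L : ℕ
    L = len (path S)
    g : ℕ → Fin n
    g = at (path S)
    bound : ∀ i → i ≤ L ∸ j → i + j ≤ L
    bound i le = subst (i + j ≤_) (m∸n+n≡m jle) (+-monoˡ-≤ j le)
  ... | inj₂ notin = record { path = extended ; starts = refl ; ends = ends S ; avoids = avoids' }
    where
    extended : Path
    extended = cons (path S) x (trans (Graph.sym G x _) (subst (λ z → adj G z x ≡ true) (sym (starts S)) e))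
                 (λ { (i , le , eq) → notin i le eq })
    avoids' : ∀ i → i ≤ len extended → at extended i ≢ v
    avoids' zero _ = px
    avoids' (suc i) (s≤s le) = avoids S i le

  neighbours-joined⇒cycle : ∀ {v u x} → adj G v u ≡ true → adj G v x ≡ true → u ≢ x → ReachMinus G v u x → HasCycle G
  neighbours-joined⇒cycle {v} {u} {x} avu avx u≢x r with walk⇒path r
  ... | S = path⇒cycle C long closing
    where
    C : Path
    C = cons (path S) v (subst (λ z → adj G v z ≡ true) (sym (starts S)) avx) (λ { (i , le , eq) → avoids S i le eq })
    long : 2 ≤ suc (len (path S))
    long with len (path S) in eq
    ... | zero = ⊥-elim (u≢x (trans (sym (ends S)) (trans (cong (at (path S)) eq) (starts S))))
    ... | suc m = s≤s (s≤s z≤n)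
    closing : adj G (at (path S) (len (path S))) v ≡ true
    closing = subst (λ z → adj G z v ≡ true) (sym (ends S)) (trans (Graph.sym G u v) avu)


module Chords {n : ℕ} (G : Graph n) (A : Fin n → Fin n → Bool) (A⊆G : ∀ x y → A x y ≡ true → adj G x y ≡ true) where
  open Paths A
  open Cycles G using (path⇒cycle)

  chord⇒cycle : ∀ (P : Path) a b → suc (suc a) ≤ b → b ≤ len P → adj G (at P b) (at P a) ≡ true → HasCycle G
  chord⇒cycle P a b a+2≤b b≤len chord = path⇒cycle segment (gap a b a+2≤b) closing
    where
    a≤b : a ≤ b
    a≤b = ≤-trans (n≤1+n a) (≤-trans (n≤1+n (suc a)) a+2≤b)
    bound : ∀ j → j ≤ b ∸ a → a + j ≤ len P
    bound j le = ≤-trans (subst (a + j ≤_) (m+[n∸m]≡n a≤b) (+-monoʳ-≤ a le)) b≤len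
    segment : Paths.Path (adj G)
    segment = record
      { len = b ∸ a ; at = λ j → at P (a + j)
      ; inj = λ i j x y e → +-cancelˡ-≡ a i j (inj P (a + i) (a + j) (bound i x) (bound j y) e)
      ; link = λ i lt → A⊆G _ _ (subst (λ z → A (at P (a + i)) (at P z) ≡ true) (sym (+-suc a i))
                          (link P (a + i) (subst (_≤ len P) (+-suc a i) (bound (suc i) lt)))) }
    gap : ∀ a b → suc (suc a) ≤ b → 2 ≤ b ∸ a
    gap zero b h = h
    gap (suc a) (suc b) (s≤s h) = gap a b h
    closing : adj G (at P (a + (b ∸ a))) (at P (a + 0)) ≡ true
    closing rewrite m+[n∸m]≡n a≤b | +-identityʳ a = chord

adj⇒≢ : ∀ {n} (G : Graph n) {v u} → adj G v u ≡ true → u ≢ v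
adj⇒≢ G {v} avu refl = false≢true (trans (sym (Graph.irrefl G v)) avu)

module Components {n : ℕ} (T : Graph n) where
  open Walks T
  open Cycles T

  opaque
    component : Fin n → Fin n → Fin n → Bool
    component v u = Closure.reachable (λ x → not (x == v)) u

  opaque
    unfolding component

    component-sound : ∀ v u w → component v u w ≡ true → ReachMinus T v u w
    component-sound v u w e = reach-mono (λ x e' x≡v → false≢true (trans (sym (cong not (==-refl-at x≡v))) e'))
                                (Closure.reachable-sound (λ x → not (x == v)) u w e)
      where
      ==-refl-at : ∀ {x} → x ≡ v → (x == v) ≡ true
      ==-refl-at refl = ==-refl v

    component-complete : ∀ v u w → ReachMinus T v u w → component v u w ≡ true
    component-complete v u w r = Closure.reachable-complete (λ x → not (x == v)) u w
                                   (reach-mono (λ x ne → cong not (==-false ne)) r)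

  component-false : ∀ v u w → ¬ ReachMinus T v u w → component v u w ≡ false
  component-false v u w nr with boolCase (component v u w)
  ... | inj₁ t = ⊥-elim (nr (component-sound v u w t))
  ... | inj₂ f = f

  component-self : ∀ v u → u ≢ v → component v u u ≡ true
  component-self v u ne = component-complete v u u (here ne)

  component-excludes : ∀ v u → component v u v ≡ false
  component-excludes v u = component-false v u v (λ r → reach-end r refl)

  component-cong : ∀ x a b → ReachMinus T x a b → ∀ w → component x a w ≡ component x b w
  component-cong x a b r w = bool-ext (λ e → component-complete x b w (reach-trans (reach-sym r) (component-sound x a w e)))
                                      (λ e → component-complete x a w (reach-trans r (component-sound x b w e)))

  size : Fin n → Fin n → ℕ
  size v u = count (component v u)

  InOddComponent⇒parity : ∀ v u → InOddComponent T v u → parity (size v u) ≡ true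
  InOddComponent⇒parity v u (S , S⇔ , odd) = trans (cong parity (sym (count-cong S≡))) (Odd⇒parity (count S) odd)
    where
    S≡ : ∀ w → S w ≡ component v u w
    S≡ w = bool-ext (λ e → component-complete v u w (Equivalence.to (S⇔ w) e))
                    (λ e → Equivalence.from (S⇔ w) (component-sound v u w e))

  parity⇒InOddComponent : ∀ v u → parity (size v u) ≡ true → InOddComponent T v u
  parity⇒InOddComponent v u p =
    component v u , (λ w → mk⇔ (component-sound v u w) (component-complete v u w)) , parity⇒Odd (size v u) p

  -- In a tree, removing v splits off one component per neighbour of v.
  module _ (tree : IsTree T) where

    connected : Connected T
    connected = proj₁ (proj₂ tree)

    acyclic : ¬ HasCycle T
    acyclic = proj₂ (proj₂ tree)

    crossing : ∀ {v u x y} → adj T v u ≡ true → component v u x ≡ true → component v u y ≡ false →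
      adj T x y ≡ true → x ≡ u × y ≡ v
    crossing {v} {u} {x} {y} avu cx cy axy with y ≟ v
    ... | no y≢v = ⊥-elim (false≢true (trans (sym cy) (component-complete v u y (step (component-sound v u x cx) axy y≢v))))
    ... | yes refl with x ≟ u
    ...   | yes x≡u = x≡u , refl
    ...   | no x≢u = ⊥-elim (acyclic (neighbours-joined⇒cycle avu (trans (Graph.sym T y x) axy) (x≢u ∘ sym)
                                        (component-sound v u x cx)))

    sides : ∀ {v u} → adj T v u ≡ true → ∀ w → ReachMinus T v u w ⊎ ReachMinus T u v w
    sides {v} {u} avu w = go (connected u w)
      where
      go : ∀ {x} → Reach T (λ _ → ⊤) u x → ReachMinus T v u x ⊎ ReachMinus T u v x
      go (here _) = inj₁ (here (adj⇒≢ T avu))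
      go {x} (step r e _) with x ≟ v | x ≟ u
      ... | yes refl | _ = inj₂ (here (adj⇒≢ T avu ∘ sym))
      ... | no _ | yes refl = inj₁ (here (adj⇒≢ T avu))
      ... | no x≢v | no x≢u with go r
      ... | inj₁ r' = inj₁ (step r' e x≢v)
      ... | inj₂ r' = inj₂ (step r' e x≢u)

    not-both-sides : ∀ {v u w} → adj T v u ≡ true → ReachMinus T v u w → ReachMinus T u v w → ⊥
    not-both-sides {v} {u} {w} avu r₁ r₂ with reach-exit r₂ (reach-end r₁)
    ... | x , avx , r₃ with x ≟ u
    ... | yes refl = proj₁ (reach-start r₃) refl
    ... | no x≢u = acyclic (neighbours-joined⇒cycle avu avx (x≢u ∘ sym)
                     (reach-trans r₁ (reach-sym (reach-mono (λ z p → proj₂ p) r₃))))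

    sides-complementary : ∀ {v u} → adj T v u ≡ true → ∀ w → component v u w ≡ not (component u v w)
    sides-complementary {v} {u} avu w with sides avu w
    ... | inj₁ r rewrite component-complete v u w r | component-false u v w (not-both-sides avu r) = refl
    ... | inj₂ r rewrite component-complete u v w r | component-false v u w (λ r' → not-both-sides avu r' r) = refl

    size-sum : ∀ {v u} → adj T v u ≡ true → size v u + size u v ≡ n
    size-sum {v} {u} avu = trans (+-comm (size v u) (size u v))
      (count-partition (component u v) (component v u) (sides-complementary avu))

    neighbour-exists : ∀ v w → w ≢ v → ∃[ u ] (adj T v u ≡ true × component v u w ≡ true)
    neighbour-exists v w w≢v with reach-exit (connected v w) w≢v
    ... | x , a , r = x , a , component-complete v x w (reach-mono (λ z p → proj₂ p) r)

    neighbour-unique : ∀ v w u u' → adj T v u ≡ true → adj T v u' ≡ true →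
      component v u w ≡ true → component v u' w ≡ true → u ≡ u'
    neighbour-unique v w u u' a a' c c' with u ≟ u'
    ... | yes e = e
    ... | no ne = ⊥-elim (acyclic (neighbours-joined⇒cycle a a' ne
                    (reach-trans (component-sound v u w c) (reach-sym (component-sound v u' w c')))))

module TreeParity {n : ℕ} (T : Graph n) (tree : IsTree T) where
  open Components T

  components-partition : ∀ v w → count (λ u → adj T v u ∧ component v u w) ≡ ind (not (w == v))
  components-partition v w with w ≟ v
  ... | yes refl = count-zero _ (λ u → trans (cong (adj T w u ∧_) (component-excludes w u)) (∧-zeroʳ (adj T w u)))
  ... | no w≢v with neighbour-exists tree v w w≢v
  ... | u , avu , cw = count-single _ u (subst (λ b → (b ∧ component v u w) ≡ true) (sym avu) cw)
                         (λ u' e → neighbour-unique tree v w u' u (∧-true₁ e) avu (∧-true₂ e) cw)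

  odd-neighbours-parity : ∀ v → parity (count (λ u → adj T v u ∧ parity (size v u))) ≡ not (parity n)
  odd-neighbours-parity v = begin
      parity (count (λ u → adj T v u ∧ parity (size v u)))
    ≡⟨ cong parity (count≡sum (λ u → adj T v u ∧ parity (size v u))) ⟩
      parity (sum (λ u → ind (adj T v u ∧ parity (size v u))))
    ≡⟨ parity-sum-cong _ _ term ⟩
      parity (sum (λ u → sum (λ w → ind (C u w))))
    ≡⟨ cong parity (∑-comm (λ u w → ind (C u w))) ⟩
      parity (sum (λ w → sum (λ u → ind (C u w))))
    ≡⟨ cong parity (sum-cong-≗ (λ w → trans (sym (count≡sum (λ u → C u w))) (components-partition v w))) ⟩
      parity (sum (λ w → ind (not (w == v))))
    ≡⟨ cong parity (sym (count≡sum (λ w → not (w == v)))) ⟩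
      parity (count (λ w → not (w == v)))
    ≡⟨ others ⟩
      not (parity n)
    ∎
    where
    open ≡-Reasoning
    C : Fin n → Fin n → Bool
    C u w = adj T v u ∧ component v u w
    term : ∀ u → parity (ind (adj T v u ∧ parity (size v u))) ≡ parity (sum (λ w → ind (C u w)))
    term u rewrite parity-ind (adj T v u ∧ parity (size v u)) | sym (count≡sum (C u)) with adj T v u
    ... | true = refl
    ... | false = cong parity (sym (count-zero {n} (λ w → false) (λ _ → refl)))
    others : parity (count (λ w → not (w == v))) ≡ not (parity n)
    others = begin
        parity k
      ≡⟨ sym (not-involutive (parity k)) ⟩
        not (parity (suc k))
      ≡⟨ cong (not ∘ parity) (trans (+-comm 1 k) (trans (cong (k +_) (sym one)) partition)) ⟩
        not (parity n)
      ∎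
      where
      k : ℕ
      k = count (λ w → not (w == v))
      one : count (_== v) ≡ 1
      one = count-single (_== v) v (==-refl v) (λ i → ==-true)
      partition : k + count (_== v) ≡ n
      partition = count-partition (λ w → not (w == v)) (_== v) (λ w → sym (not-involutive (w == v)))

  -- The key parity fact: in a subgraph D of T with all degrees odd, the edge vu
  -- belongs to D exactly when the component of T - v containing u is odd.
  -- Summing degrees over that component C counts every D-edge inside C twice
  -- and the single crossing edge vu (if present) once.
  module OddSubgraph (D : Fin n → Fin n → Bool) (D-sym : ∀ x y → D x y ≡ D y x) (D-irr : ∀ x → D x x ≡ false)
                     (D⊆T : ∀ x y → D x y ≡ true → adj T x y ≡ true) (D-odd : ∀ x → parity (count (D x)) ≡ true) where

    module Crossing (v u : Fin n) (avu : adj T v u ≡ true) where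
      C : Fin n → Bool
      C = component v u

      inside outgoing : Fin n → Fin n → Bool
      inside x y = (C x ∧ D x y) ∧ C y
      outgoing x y = (C x ∧ D x y) ∧ not (C y)

      inside-sym : ∀ x y → inside x y ≡ inside y x
      inside-sym x y rewrite D-sym x y with C x | C y | D y x
      ... | true | true | d = refl
      ... | true | false | true = refl
      ... | true | false | false = refl
      ... | false | true | true = refl
      ... | false | true | false = refl
      ... | false | false | d = refl

      inside-irr : ∀ x → inside x x ≡ false
      inside-irr x rewrite D-irr x with C x
      ... | true = refl
      ... | false = refl

      degree-in-C : ∀ x → parity (ind (C x)) ≡ parity (count (λ y → C x ∧ D x y))
      degree-in-C x rewrite parity-ind (C x) with C x
      ... | true = sym (D-odd x)
      ... | false = cong parity (sym (count-zero {n} (λ w → false) (λ _ → refl)))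

      outgoing-edge : ∀ x y → outgoing x y ≡ true → x ≡ u × y ≡ v
      outgoing-edge x y t = crossing tree avu (∧-true₁ {C x} (∧-true₁ {C x ∧ D x y} t))
                              (not-true (∧-true₂ {C x ∧ D x y} t)) (D⊆T x y (∧-true₂ {C x} (∧-true₁ {C x ∧ D x y} t)))

      no-outgoing : ∀ x → x ≢ u → count (outgoing x) ≡ 0
      no-outgoing x x≢u = count-zero (outgoing x) none
        where
        none : ∀ y → outgoing x y ≡ false
        none y with boolCase (outgoing x y)
        ... | inj₂ f = f
        ... | inj₁ t = ⊥-elim (x≢u (proj₁ (outgoing-edge x y t)))

      outgoing-uv : outgoing u v ≡ D v u
      outgoing-uv rewrite component-self v u (adj⇒≢ T avu) | component-excludes v u | D-sym u v with D v u
      ... | true = refl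
      ... | false = refl

      outgoing-at-u : parity (count (outgoing u)) ≡ D v u
      outgoing-at-u with boolCase (D v u)
      ... | inj₁ t = trans (cong parity (count-single (outgoing u) v (trans outgoing-uv t) (λ y e → proj₂ (outgoing-edge u y e)))) (sym t)
      ... | inj₂ f = trans (cong parity (count-zero (outgoing u) none)) (sym f)
        where
        none : ∀ y → outgoing u y ≡ false
        none y with boolCase (outgoing u y)
        ... | inj₂ g = g
        ... | inj₁ t with proj₂ (outgoing-edge u y t)
        ... | refl = ⊥-elim (false≢true (trans (sym f) (trans (sym outgoing-uv) t)))

    oddSubgraph-edge : ∀ v u → adj T v u ≡ true → D v u ≡ parity (size v u)
    oddSubgraph-edge v u avu = sym (begin
        parity (count C)
      ≡⟨ cong parity (count≡sum C) ⟩
        parity (sum (λ x → ind (C x)))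
      ≡⟨ parity-sum-cong _ _ degree-in-C ⟩
        parity (sum (λ x → count (λ y → C x ∧ D x y)))
      ≡⟨ cong parity (sum-cong-≗ (λ x → count-split (λ y → C x ∧ D x y) C)) ⟩
        parity (sum (λ x → count (inside x) + count (outgoing x)))
      ≡⟨ cong parity (∑-distrib-+ (λ x → count (inside x)) (λ x → count (outgoing x))) ⟩
        parity (sum (λ x → count (inside x)) + sum (λ x → count (outgoing x)))
      ≡⟨ parity-+ (sum (λ x → count (inside x))) (sum (λ x → count (outgoing x))) ⟩
        parity (sum (λ x → count (inside x))) xor parity (sum (λ x → count (outgoing x)))
      ≡⟨ cong (_xor parity (sum (λ x → count (outgoing x)))) (handshake inside inside-sym inside-irr) ⟩
        parity (sum (λ x → count (outgoing x)))
      ≡⟨ cong parity (sum-single (λ x → count (outgoing x)) u no-outgoing) ⟩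
        parity (count (outgoing u))
      ≡⟨ outgoing-at-u ⟩
        D v u
      ∎)
      where
      open ≡-Reasoning
      open Crossing v u avu

module Caterpillar {n : ℕ} {G : Graph n} (H : Subgraph G) (cat : IsCaterpillar G H) where
  open IsCaterpillar cat

  OnSpine : Fin n → Set
  OnSpine x = ∃[ i ] spine i ≡ x

  two-neighbours⇒spine : ∀ x y z → vert H x ≡ true → edge H x y ≡ true → edge H x z ≡ true → y ≢ z → OnSpine x
  two-neighbours⇒spine x y z vx ey ez y≢z with any? (λ i → spine i ≟ x)
  ... | yes s = s
  ... | no ns with leaves x vx ns
  ... | w , _ , unique = ⊥-elim (y≢z (trans (unique y ey) (sym (unique z ez))))

  has-neighbour : ∀ x → vert H x ≡ true → ∃[ y ] edge H x y ≡ true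
  has-neighbour x vx with any? (λ i → spine i ≟ x)
  ... | no ns with leaves x vx ns
  ... | y , e , _ = y , e
  has-neighbour x vx | yes (i , refl) = go k i spine path-edge has-edge edges-ok
    where
    -- generalised over the spine so that its length can be inspected
    go : ∀ k' (i : Fin (suc k')) (sp : Fin (suc k') → Fin n) →
         (∀ (j : Fin k') → edge H (sp (inject₁ j)) (sp (suc j)) ≡ true) →
         (∃[ a ] ∃[ b ] edge H a b ≡ true) →
         (∀ x y → edge H x y ≡ true →
          (∃[ j ] ((x ≡ sp (inject₁ j) × y ≡ sp (suc j)) ⊎ (y ≡ sp (inject₁ j) × x ≡ sp (suc j))))
          ⊎ ((∃[ j ] sp j ≡ x) × ¬ (∃[ j ] sp j ≡ y))
          ⊎ (¬ (∃[ j ] sp j ≡ x) × (∃[ j ] sp j ≡ y))) →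
         ∃[ y ] edge H (sp i) y ≡ true
    go zero zero sp pe (a , b , eab) ok with ok a b eab
    ... | inj₁ (() , _)
    ... | inj₂ (inj₁ ((zero , refl) , _)) = b , eab
    ... | inj₂ (inj₂ (_ , (zero , refl))) = a , trans (edge-sym H b a) eab
    go (suc k') zero sp pe he ok = sp (suc zero) , pe zero
    go (suc k') (suc i) sp pe he ok = sp (inject₁ i) , trans (edge-sym H (sp (suc i)) (sp (inject₁ i))) (pe i)

  spine-edge : ∀ p q → edge H (spine p) (spine q) ≡ true → toℕ q ≡ suc (toℕ p) ⊎ toℕ p ≡ suc (toℕ q)
  spine-edge p q e with edges-ok (spine p) (spine q) e
  ... | inj₁ (i , inj₁ (e₁ , e₂)) = inj₁ (trans (cong toℕ (spine-inj e₂)) (cong suc (trans (sym (toℕ-inject₁ i)) (cong toℕ (sym (spine-inj e₁))))))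
  ... | inj₁ (i , inj₂ (e₁ , e₂)) = inj₂ (trans (cong toℕ (spine-inj e₂)) (cong suc (trans (sym (toℕ-inject₁ i)) (cong toℕ (sym (spine-inj e₁))))))
  ... | inj₂ (inj₁ (_ , ns)) = ⊥-elim (ns (q , refl))
  ... | inj₂ (inj₂ (ns , _)) = ⊥-elim (ns (p , refl))

  no-three-spine-neighbours : ∀ p q₁ q₂ q₃ → edge H (spine p) (spine q₁) ≡ true → edge H (spine p) (spine q₂) ≡ true →
    edge H (spine p) (spine q₃) ≡ true → q₁ ≢ q₂ → q₁ ≢ q₃ → q₂ ≢ q₃ → ⊥
  no-three-spine-neighbours p q₁ q₂ q₃ e₁ e₂ e₃ n₁₂ n₁₃ n₂₃ with spine-edge p q₁ e₁ | spine-edge p q₂ e₂ | spine-edge p q₃ e₃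
  ... | inj₁ a | inj₁ b | _ = n₁₂ (toℕ-injective (trans a (sym b)))
  ... | inj₂ a | inj₂ b | _ = n₁₂ (toℕ-injective (suc-injective (trans (sym a) b)))
  ... | inj₁ a | inj₂ b | inj₁ c = n₁₃ (toℕ-injective (trans a (sym c)))
  ... | inj₁ a | inj₂ b | inj₂ c = n₂₃ (toℕ-injective (suc-injective (trans (sym b) c)))
  ... | inj₂ a | inj₁ b | inj₁ c = n₂₃ (toℕ-injective (trans b (sym c)))
  ... | inj₂ a | inj₁ b | inj₂ c = n₁₃ (toℕ-injective (suc-injective (trans (sym a) c)))

module Necessity {n : ℕ} (T : Graph n) (tree : IsTree T) (fac : HasOddCaterpillarFactor T) where
  open Walks T
  open Components T
  open TreeParity T tree

  m : ℕ
  m = proj₁ fac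

  F : Fin m → Subgraph T
  F = proj₁ (proj₂ fac)

  oddCats : ∀ j → IsOddCaterpillar T (F j)
  oddCats = proj₁ (proj₂ (proj₂ fac))

  covers : ∀ v → ∃[ j ] (vert (F j) v ≡ true × (∀ j' → vert (F j') v ≡ true → j' ≡ j))
  covers = proj₂ (proj₂ (proj₂ fac))

  part : Fin n → Fin m
  part x = proj₁ (covers x)

  in-part : ∀ x → vert (F (part x)) x ≡ true
  in-part x = proj₁ (proj₂ (covers x))

  part-unique : ∀ x j → vert (F j) x ≡ true → j ≡ part x
  part-unique x = proj₂ (proj₂ (covers x))

  -- D: the union of the edge sets of the factor
  D : Fin n → Fin n → Bool
  D x y = edge (F (part x)) x y

  D-part : ∀ x y → D x y ≡ true → part y ≡ part x
  D-part x y e = sym (part-unique y (part x) (edge-vert (F (part x)) y x (trans (edge-sym (F (part x)) y x) e)))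

  D-sym : ∀ x y → D x y ≡ D y x
  D-sym x y = bool-ext (flip x y) (flip y x)
    where
    flip : ∀ x y → D x y ≡ true → D y x ≡ true
    flip x y e rewrite D-part x y e = trans (edge-sym (F (part x)) y x) e

  D⊆T : ∀ x y → D x y ≡ true → adj T x y ≡ true
  D⊆T x y = edge-adj (F (part x)) x y

  D-irr : ∀ x → D x x ≡ false
  D-irr x with boolCase (D x x)
  ... | inj₂ f = f
  ... | inj₁ t = ⊥-elim (adj⇒≢ T (D⊆T x x t) refl)

  -- every degree in an odd caterpillar is odd (leaves have degree 1)
  D-odd : ∀ x → parity (count (D x)) ≡ true
  D-odd x with 2 ≤? count (D x)
  ... | yes le = Odd⇒parity (count (D x)) (proj₂ (oddCats (part x)) x (in-part x) le)
  ... | no nle with Caterpillar.has-neighbour (F (part x)) (proj₁ (oddCats (part x))) x (in-part x)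
  ... | y , e = cong parity (≤-antisym (≤-pred (≰⇒> nle)) (count-pos (D x) y e))

  even-order : Even n
  even-order = parity⇒Even n (begin
      parity n                           ≡⟨ cong parity (sym (sum-ones n)) ⟩
      parity (sum {n} (λ _ → 1))         ≡⟨ parity-sum-cong (λ _ → 1) (λ x → count (D x)) (λ x → sym (D-odd x)) ⟩
      parity (sum (λ x → count (D x)))   ≡⟨ handshake D D-sym D-irr ⟩
      false                              ∎)
    where open ≡-Reasoning

  open OddSubgraph D D-sym D-irr D⊆T D-odd

  odd-component-neighbour : ∀ x a → InOddComponent T x a → ∃[ y ] (D x y ≡ true × ReachMinus T x y a)
  odd-component-neighbour x a odd with a ≟ x
  ... | yes refl = ⊥-elim (false≢true (trans (sym (cong parity (count-zero (component x x)
                     (λ w → component-false x x w (λ r → reach-start r refl))))) (InOddComponent⇒parity x a odd)))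
  ... | no a≢x with neighbour-exists tree x a a≢x
  ... | y , axy , c = y , trans (oddSubgraph-edge x y axy) (trans (cong parity (count-cong (component-cong x y a r)))
                                                               (InOddComponent⇒parity x a odd)) , r
    where
    r : ReachMinus T x y a
    r = component-sound x y a c

  B-vertex-two-neighbours : ∀ x → IsBVertex T x → ∃[ y ] ∃[ z ] (D x y ≡ true × D x z ≡ true × y ≢ z)
  B-vertex-two-neighbours x (a , b , c , oa , ob , oc , nab , nac , nbc)
    with odd-component-neighbour x a oa | odd-component-neighbour x b ob
  ... | y , dy , ry | z , dz , rz = y , z , dy , dz , λ { refl → nab (reach-trans (reach-sym ry) rz) }

  condition : Condition T
  condition v (u₁ , u₂ , u₃ , n₁₂ , n₁₃ , n₂₃ , (a₁ , b₁ , o₁) , (a₂ , b₂ , o₂) , (a₃ , b₃ , o₃)) =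
    no-three-spine-neighbours p (spine-index s₁) (spine-index s₂) (spine-index s₃)
      (spine-edge-at s₁ d₁) (spine-edge-at s₂ d₂) (spine-edge-at s₃ d₃)
      (distinct s₁ s₂ n₁₂) (distinct s₁ s₃ n₁₃) (distinct s₂ s₃ n₂₃)
    where
    H : Subgraph T
    H = F (part v)
    cat : IsCaterpillar T H
    cat = proj₁ (oddCats (part v))
    open IsCaterpillar cat using (spine)
    open Caterpillar H cat

    D-neighbour : ∀ u → adj T v u ≡ true → InOddComponent T v u → D v u ≡ true
    D-neighbour u a o = trans (oddSubgraph-edge v u a) (InOddComponent⇒parity v u o)
    d₁ : D v u₁ ≡ true
    d₁ = D-neighbour u₁ a₁ o₁
    d₂ : D v u₂ ≡ true
    d₂ = D-neighbour u₂ a₂ o₂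
    d₃ : D v u₃ ≡ true
    d₃ = D-neighbour u₃ a₃ o₃

    v-on-spine : OnSpine v
    v-on-spine = two-neighbours⇒spine v u₁ u₂ (in-part v) d₁ d₂ n₁₂
    p : Fin (suc (IsCaterpillar.k cat))
    p = proj₁ v-on-spine

    B-on-spine : ∀ u → D v u ≡ true → IsBVertex T u → OnSpine u
    B-on-spine u d b with B-vertex-two-neighbours u b
    ... | y , z , dy , dz , y≢z rewrite D-part v u d =
      two-neighbours⇒spine u y z (edge-vert H u v (trans (edge-sym H u v) d)) dy dz y≢z
    s₁ : OnSpine u₁
    s₁ = B-on-spine u₁ d₁ b₁
    s₂ : OnSpine u₂
    s₂ = B-on-spine u₂ d₂ b₂
    s₃ : OnSpine u₃
    s₃ = B-on-spine u₃ d₃ b₃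

    spine-index : ∀ {u} → OnSpine u → Fin (suc (IsCaterpillar.k cat))
    spine-index = proj₁

    spine-edge-at : ∀ {u} (s : OnSpine u) → D v u ≡ true → edge H (spine p) (spine (spine-index s)) ≡ true
    spine-edge-at (q , refl) d = subst (λ z → edge H z (spine q) ≡ true) (sym (proj₂ v-on-spine)) d

    distinct : ∀ {u u'} (s : OnSpine u) (s' : OnSpine u') → u ≢ u' → spine-index s ≢ spine-index s'
    distinct (q , refl) (q' , refl) ne e = ne (cong spine e)

module OddEdges {n : ℕ} (T : Graph n) (tree : IsTree T) (even : Even n) (cond : Condition T) where
  open Components T
  open TreeParity T tree

  D : Fin n → Fin n → Bool
  D v u = adj T v u ∧ parity (size v u)

  parity-n : parity n ≡ false
  parity-n = Even⇒parity n even

  -- the two sides of an edge have sizes adding up to the even number n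
  D-sym : ∀ x y → D x y ≡ D y x
  D-sym x y with adj T x y in axy
  ... | false = sym (cong (_∧ parity (size y x)) (trans (Graph.sym T y x) axy))
  ... | true = trans (same-parity (parity (size x y)) (parity (size y x))
                        (trans (sym (parity-+ (size x y) (size y x))) (trans (cong parity (size-sum tree axy)) parity-n)))
                     (cong (_∧ parity (size y x)) (sym (trans (Graph.sym T y x) axy)))
    where
    same-parity : ∀ a b → a xor b ≡ false → a ≡ b
    same-parity true true _ = refl
    same-parity false false _ = refl

  D-irr : ∀ x → D x x ≡ false
  D-irr x rewrite Graph.irrefl T x = refl

  D⊆T : ∀ x y → D x y ≡ true → adj T x y ≡ true
  D⊆T x y = ∧-true₁

  D-odd : ∀ x → parity (count (D x)) ≡ true
  D-odd x = trans (odd-neighbours-parity x) (cong not parity-n)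

  DG : Graph n
  DG = record { adj = D ; sym = D-sym ; irrefl = D-irr }

  -- non-leaves of D: vertices of D-degree at least 2 (hence at least 3)
  nonleaf : Fin n → Bool
  nonleaf x with 2 ≤? count (D x)
  ... | yes _ = true
  ... | no _ = false

  nonleaf-degree : ∀ x → nonleaf x ≡ true → 2 ≤ count (D x)
  nonleaf-degree x e with 2 ≤? count (D x)
  ... | yes le = le

  nonleaf-intro : ∀ x → 2 ≤ count (D x) → nonleaf x ≡ true
  nonleaf-intro x le with 2 ≤? count (D x)
  ... | yes _ = refl
  ... | no nle = ⊥-elim (nle le)

  leaf-unique : ∀ x → nonleaf x ≡ false → ∀ y z → D x y ≡ true → D x z ≡ true → y ≡ z
  leaf-unique x f y z dy dz with y ≟ z
  ... | yes e = e
  ... | no ne = ⊥-elim (false≢true (trans (sym f) (nonleaf-intro x (count-two (D x) y z dy dz ne))))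

  has-neighbour : ∀ x → ∃[ y ] D x y ≡ true
  has-neighbour x = count-find (D x) (positive (count (D x)) (D-odd x))
    where
    positive : ∀ c → parity c ≡ true → 1 ≤ c
    positive (suc c) _ = s≤s z≤n

  nonleaf-three : ∀ x → nonleaf x ≡ true → 3 ≤ count (D x)
  nonleaf-three x e = odd≥2⇒≥3 (count (D x)) (nonleaf-degree x e) (D-odd x)
    where
    odd≥2⇒≥3 : ∀ c → 2 ≤ c → parity c ≡ true → 3 ≤ c
    odd≥2⇒≥3 (suc zero) (s≤s ()) _
    odd≥2⇒≥3 (suc (suc zero)) _ ()
    odd≥2⇒≥3 (suc (suc (suc c))) _ _ = s≤s (s≤s (s≤s z≤n))

  D-odd-component : ∀ x y → D x y ≡ true → InOddComponent T x y
  D-odd-component x y e = parity⇒InOddComponent x y (∧-true₂ e)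

  D-separated : ∀ x a b → D x a ≡ true → D x b ≡ true → a ≢ b → ¬ ReachMinus T x a b
  D-separated x a b da db a≢b r = acyclic tree (Cycles.neighbours-joined⇒cycle T (D⊆T x a da) (D⊆T x b db) a≢b r)

  -- three D-neighbours lie in three distinct odd components, so a non-leaf is a B-vertex
  nonleaf⇒B : ∀ x → nonleaf x ≡ true → IsBVertex T x
  nonleaf⇒B x e = three-components (count-find3 (D x) (nonleaf-three x e))
    where
    three-components : (∃[ a ] ∃[ b ] ∃[ c ] (D x a ≡ true × D x b ≡ true × D x c ≡ true × a ≢ b × a ≢ c × b ≢ c)) →
      IsBVertex T x
    three-components (a , b , c , da , db , dc , nab , nac , nbc) =
      a , b , c , D-odd-component x a da , D-odd-component x b db , D-odd-component x c dc ,
      D-separated x a b da db nab , D-separated x a c da dc nac , D-separated x b c db dc nbc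

  no-three-nonleaf-neighbours : ∀ v a b c → D v a ≡ true → D v b ≡ true → D v c ≡ true →
    nonleaf a ≡ true → nonleaf b ≡ true → nonleaf c ≡ true → a ≢ b → a ≢ c → b ≢ c → ⊥
  no-three-nonleaf-neighbours v a b c da db dc na nb nc nab nac nbc =
    cond v (a , b , c , nab , nac , nbc , (D⊆T v a da , nonleaf⇒B a na , D-odd-component v a da) ,
           (D⊆T v b db , nonleaf⇒B b nb , D-odd-component v b db) , (D⊆T v c dc , nonleaf⇒B c nc , D-odd-component v c dc))

-- Sufficiency, step 2: in each component of D the non-leaves lie on one
-- D-path.  Such a spine is found by extending a path at its front by a
-- non-leaf neighbour not yet on it, as long as possible, then reversing it
-- and extending again.  An interior spine vertex has its two spine
-- neighbours, so by the Condition it has no further non-leaf neighbour.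

module Spines {n : ℕ} (T : Graph n) (tree : IsTree T) (even : Even n) (cond : Condition T) where
  open OddEdges T tree even cond
  open Walks DG
  open Paths D

  Linked : Fin n → Fin n → Set
  Linked = Reach DG (λ _ → true ≡ true)

  Shape : Path → Set
  Shape P = (∀ i → i ≤ len P → nonleaf (at P i) ≡ true)
          ⊎ (len P ≡ 0 × (∀ y → D (at P 0) y ≡ true → nonleaf y ≡ false))

  record Trail (s : Fin n) : Set where
    field
      path   : Path
      linked : ∀ i → i ≤ len path → Linked s (at path i)
      shape  : Shape path
  open Trail

  reverseTrail : ∀ {s} → Trail s → Trail s
  reverseTrail t = record
    { path = reverse D-sym (path t)
    ; linked = λ i le → linked t (len (path t) ∸ i) (m∸n≤m _ i)
    ; shape = reversed (shape t) }
    where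
    reversed : Shape (path t) → Shape (reverse D-sym (path t))
    reversed (inj₁ f) = inj₁ (λ i le → f (len (path t) ∸ i) (m∸n≤m _ i))
    reversed (inj₂ (z , f)) = inj₂ (z , subst (λ w → ∀ y → D (at (path t) w) y ≡ true → nonleaf y ≡ false) (sym z) f)

  Saturated : Path → Fin n → Set
  Saturated P x = ∀ y → D x y ≡ true → nonleaf y ≡ true → y ∈P P

  Extension : Path → Set
  Extension P = ∃[ y ] (D (at P 0) y ≡ true × nonleaf y ≡ true × ¬ y ∈P P)

  extension? : (P : Path) → Dec (Extension P)
  extension? P = any? candidate
    where
    candidate : ∀ y → Dec (D (at P 0) y ≡ true × nonleaf y ≡ true × ¬ y ∈P P)
    candidate y with boolCase (D (at P 0) y) | boolCase (nonleaf y) | y ∈P? P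
    ... | inj₁ a | inj₁ b | inj₂ c = yes (a , b , c)
    ... | inj₂ a | _ | _ = no (λ h → false≢true (trans (sym a) (proj₁ h)))
    ... | inj₁ _ | inj₂ b | _ = no (λ h → false≢true (trans (sym b) (proj₁ (proj₂ h))))
    ... | inj₁ _ | inj₁ _ | inj₁ c = no (λ h → proj₂ (proj₂ h) c)

  extend : ∀ {s} (t : Trail s) → Extension (path t) → Trail s
  extend {s} t (y , d , nly , ni) = record { path = P' ; linked = linked' ; shape = shape' (shape t) }
    where
    P' : Path
    P' = cons (path t) y (trans (D-sym y _) d) ni
    linked' : ∀ i → i ≤ len P' → Linked s (at P' i)
    linked' zero _ = step (linked t 0 z≤n) d refl
    linked' (suc i) (s≤s le) = linked t i le
    shape' : Shape (path t) → Shape P'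
    shape' (inj₁ f) = inj₁ λ { zero _ → nly ; (suc i) (s≤s le) → f i le }
    shape' (inj₂ (_ , f)) = ⊥-elim (false≢true (trans (sym (f y d)) nly))

  grow : ∀ {s} → ℕ → Trail s → Trail s
  grow zero t = t
  grow (suc f) t with extension? (path t)
  ... | no _ = t
  ... | yes x = grow f (extend t x)

  grow-⊇ : ∀ {s} f (t : Trail s) x → x ∈P path t → x ∈P path (grow f t)
  grow-⊇ zero t x m = m
  grow-⊇ (suc f) t x m with extension? (path t)
  ... | no _ = m
  ... | yes (y , d , nly , ni) = grow-⊇ f (extend t (y , d , nly , ni)) x (cons-⊇ (path t) y (trans (D-sym y _) d) ni x m)

  grow-last : ∀ {s} f (t : Trail s) → at (path (grow f t)) (len (path (grow f t))) ≡ at (path t) (len (path t))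
  grow-last zero t = refl
  grow-last (suc f) t with extension? (path t)
  ... | no _ = refl
  ... | yes x = grow-last f (extend t x)

  -- paths have fewer than n edges, so n extension rounds saturate the front
  grow-saturates : ∀ {s} f (t : Trail s) → n ≤ len (path t) + f → Saturated (path (grow f t)) (at (path (grow f t)) 0)
  grow-saturates zero t le = ⊥-elim (absurd (≤-trans (length-bound (path t)) (subst (n ≤_) (+-identityʳ _) le)))
    where
    absurd : ∀ {a} → suc a ≤ a → ⊥
    absurd {suc a} (s≤s h) = absurd h
  grow-saturates (suc f) t le with extension? (path t)
  ... | yes x = grow-saturates f (extend t x) (subst (n ≤_) (+-suc (len (path t)) f) le)
  ... | no none = saturated
    where
    saturated : Saturated (path t) (at (path t) 0)
    saturated y d nly with y ∈P? path t
    ... | inj₁ m = m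
    ... | inj₂ ni = ⊥-elim (none (y , d , nly , ni))

  module FromSeed (s : Fin n) (seed : nonleaf s ≡ true ⊎ (∀ y → D s y ≡ true → nonleaf y ≡ false)) where

    start : Trail s
    start = record { path = single s ; linked = λ _ _ → here refl ; shape = shape₀ seed }
      where
      shape₀ : nonleaf s ≡ true ⊎ (∀ y → D s y ≡ true → nonleaf y ≡ false) → Shape (single s)
      shape₀ (inj₁ e) = inj₁ (λ { zero _ → e })
      shape₀ (inj₂ f) = inj₂ (refl , f)

    forward : Trail s
    forward = grow n start

    spineTrail : Trail s
    spineTrail = grow n (reverseTrail forward)

    Q : Path
    Q = path spineTrail

    forward⊆Q : ∀ x → x ∈P path forward → x ∈P Q
    forward⊆Q x m = grow-⊇ n (reverseTrail forward) x (reverse-⊇ D-sym (path forward) x m)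

    s∈Q : s ∈P Q
    s∈Q = forward⊆Q s (grow-⊇ n start s (0 , z≤n , refl))

    front-saturated : Saturated Q (at Q 0)
    front-saturated = grow-saturates n (reverseTrail forward) (m≤n+m n _)

    back-saturated : Saturated Q (at Q (len Q))
    back-saturated y d nly = forward⊆Q y (grow-saturates n start (m≤n+m n 0) y (subst (λ z → D z y ≡ true) back≡ d) nly)
      where
      back≡ : at Q (len Q) ≡ at (path forward) 0
      back≡ = trans (grow-last n (reverseTrail forward)) (cong (at (path forward)) (n∸n≡0 (len (path forward))))

    saturated : ∀ i → i ≤ len Q → Saturated Q (at Q i)
    saturated zero _ = front-saturated
    saturated (suc i) le y d nly with m≤n⇒m<n∨m≡n le
    ... | inj₂ eq = back-saturated y (subst (λ z → D (at Q z) y ≡ true) eq d) nly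
    ... | inj₁ lt with y ∈P? Q
    ... | inj₁ m = m
    ... | inj₂ ni with shape spineTrail
    ... | inj₂ (z , _) = ⊥-elim (no-interior (subst (suc (suc i) ≤_) z lt))
      where
      no-interior : ∀ {a} → suc (suc a) ≤ 0 → ⊥
      no-interior ()
    ... | inj₁ f = ⊥-elim (no-three-nonleaf-neighbours (at Q (suc i)) (at Q i) (at Q (suc (suc i))) y
        (trans (D-sym _ _) (link Q i le)) (link Q (suc i) lt) d
        (f i (≤-trans (n≤1+n i) le)) (f (suc (suc i)) lt) nly
        (λ e → i≢i+2 (inj Q i (suc (suc i)) (≤-trans (n≤1+n i) le) lt e))
        (λ e → ni (i , ≤-trans (n≤1+n i) le , e))
        (λ e → ni (suc (suc i) , lt , e)))
      where
      i≢i+2 : ∀ {a} → a ≢ suc (suc a)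
      i≢i+2 ()

    spine-or-leaf : ∀ x → Linked s x → x ∈P Q ⊎ (nonleaf x ≡ false × ∃[ z ] (z ∈P Q × D x z ≡ true))
    spine-or-leaf x (here _) = inj₁ s∈Q
    spine-or-leaf x (step {w} r d _) with spine-or-leaf w r
    ... | inj₂ (fw , z , mz , dz) = inj₁ (subst (_∈P Q) (sym (leaf-unique w fw x z d dz)) mz)
    ... | inj₁ (i , le , eq) with boolCase (nonleaf x)
    ...   | inj₁ t = inj₁ (saturated i le x (subst (λ z → D z x ≡ true) (sym eq) d) t)
    ...   | inj₂ f = inj₂ (f , w , (i , le , eq) , trans (D-sym x w) d)

module ComponentCaterpillars {n : ℕ} (T : Graph n) (tree : IsTree T) (even : Even n) (cond : Condition T) where
  open OddEdges T tree even cond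
  open Spines T tree even cond
  open Walks DG
  open Paths D
  open Components T using (acyclic)

  opaque
    componentD : Fin n → Fin n → Bool
    componentD r = Closure.reachable (λ _ → true) r

  opaque
    unfolding componentD

    componentD-sound : ∀ r w → componentD r w ≡ true → Linked r w
    componentD-sound r = Closure.reachable-sound (λ _ → true) r

    componentD-complete : ∀ r w → Linked r w → componentD r w ≡ true
    componentD-complete r = Closure.reachable-complete (λ _ → true) r

  componentD-cong : ∀ u v → Linked u v → ∀ w → componentD u w ≡ componentD v w
  componentD-cong u v l w = bool-ext (λ e → componentD-complete v w (reach-trans (reach-sym l) (componentD-sound u w e)))
                                     (λ e → componentD-complete u w (reach-trans l (componentD-sound v w e)))

  componentD-edge : ∀ r x y → D x y ≡ true → componentD r x ≡ componentD r y
  componentD-edge r x y d = bool-ext (λ e → componentD-complete r y (step (componentD-sound r x e) d refl))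
                                     (λ e → componentD-complete r x (step (componentD-sound r y e) (trans (D-sym y x) d) refl))

  module Build (r s : Fin n) (rs : Linked r s) (seed : nonleaf s ≡ true ⊎ (∀ y → D s y ≡ true → nonleaf y ≡ false)) where
    open FromSeed s seed

    H : Subgraph T
    H = record
      { vert = componentD r
      ; edge = λ x y → componentD r x ∧ D x y
      ; edge-sym = λ x y → symmetric (D-sym x y) (componentD-edge r x y)
      ; edge-adj = λ x y e → D⊆T x y (∧-true₂ {componentD r x} e)
      ; edge-vert = λ x y e → ∧-true₁ e }
      where
      symmetric : ∀ {a b c d} → c ≡ d → (c ≡ true → a ≡ b) → (a ∧ c) ≡ (b ∧ d)
      symmetric {c = true} refl f = cong (_∧ true) (f refl)
      symmetric {a} {b} {c = false} refl f = trans (∧-zeroʳ a) (sym (∧-zeroʳ b))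

    Q-in-component : ∀ i → i ≤ len Q → componentD r (at Q i) ≡ true
    Q-in-component i le = componentD-complete r (at Q i) (reach-trans rs (Trail.linked spineTrail i le))

    linked-to-seed : ∀ x → componentD r x ≡ true → Linked s x
    linked-to-seed x e = reach-trans (reach-sym rs) (componentD-sound r x e)

    spine : Fin (suc (len Q)) → Fin n
    spine f = at Q (toℕ f)

    ∈Q⇒spine : ∀ {x} → x ∈P Q → ∃[ i ] spine i ≡ x
    ∈Q⇒spine (a , le , e) = fromℕ< (s≤s le) , trans (cong (at Q) (toℕ-fromℕ< (s≤s le))) e

    spine⇒∈Q : ∀ {x} → ∃[ i ] spine i ≡ x → x ∈P Q
    spine⇒∈Q (f , e) = toℕ f , toℕ≤pred[n] f , e

    -- spine vertices joined by D are consecutive, since T has no cycle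
    consecutive : ∀ a b → a ≤ len Q → b ≤ len Q → D (at Q a) (at Q b) ≡ true →
      ∃[ i ] ((at Q a ≡ spine (inject₁ i) × at Q b ≡ spine (suc i)) ⊎ (at Q b ≡ spine (inject₁ i) × at Q a ≡ spine (suc i)))
    consecutive a b la lb d with <-cmp a b
    ... | tri≈ _ refl _ = ⊥-elim (false≢true (trans (sym (D-irr (at Q a))) d))
    ... | tri< a<b _ _ with m≤n⇒m<n∨m≡n a<b
    ...   | inj₁ a+1<b = ⊥-elim (acyclic tree (Chords.chord⇒cycle T D D⊆T Q a b a+1<b lb (D⊆T _ _ (trans (D-sym _ _) d))))
    ...   | inj₂ refl = fromℕ< lb , inj₁ (cong (at Q) (sym (trans (toℕ-inject₁ _) (toℕ-fromℕ< lb))) , cong (at Q) (cong suc (sym (toℕ-fromℕ< lb))))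
    consecutive a b la lb d | tri> _ _ b<a with m≤n⇒m<n∨m≡n b<a
    ...   | inj₁ b+1<a = ⊥-elim (acyclic tree (Chords.chord⇒cycle T D D⊆T Q b a b+1<a la (D⊆T _ _ d)))
    ...   | inj₂ refl = fromℕ< la , inj₂ (cong (at Q) (sym (trans (toℕ-inject₁ _) (toℕ-fromℕ< la))) , cong (at Q) (cong suc (sym (toℕ-fromℕ< la))))

    off-spine-edge : ∀ x y → componentD r x ≡ true → D x y ≡ true → ¬ x ∈P Q → ¬ y ∈P Q → ⊥
    off-spine-edge x y cx d nx ny with spine-or-leaf x (linked-to-seed x cx)
    ... | inj₁ m = nx m
    ... | inj₂ (fx , z , mz , dz) = ny (subst (_∈P Q) (sym (leaf-unique x fx y z d dz)) mz)

    edges-ok : ∀ x y → (componentD r x ∧ D x y) ≡ true →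
          (∃[ i ] ((x ≡ spine (inject₁ i) × y ≡ spine (suc i)) ⊎ (y ≡ spine (inject₁ i) × x ≡ spine (suc i))))
        ⊎ ((∃[ i ] spine i ≡ x) × ¬ (∃[ i ] spine i ≡ y))
        ⊎ (¬ (∃[ i ] spine i ≡ x) × (∃[ i ] spine i ≡ y))
    edges-ok x y e with x ∈P? Q | y ∈P? Q
    ... | inj₁ (a , la , refl) | inj₁ (b , lb , refl) = inj₁ (consecutive a b la lb (∧-true₂ {componentD r x} e))
    ... | inj₁ mx | inj₂ ny = inj₂ (inj₁ (∈Q⇒spine mx , ny ∘ spine⇒∈Q))
    ... | inj₂ nx | inj₁ my = inj₂ (inj₂ (nx ∘ spine⇒∈Q , ∈Q⇒spine my))
    ... | inj₂ nx | inj₂ ny = ⊥-elim (off-spine-edge x y (∧-true₁ e) (∧-true₂ {componentD r x} e) nx ny)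

    leaves-ok : ∀ x → componentD r x ≡ true → ¬ (∃[ i ] spine i ≡ x) →
          ∃[ y ] ((componentD r x ∧ D x y) ≡ true × (∀ z → (componentD r x ∧ D x z) ≡ true → z ≡ y))
    leaves-ok x cx ns with spine-or-leaf x (linked-to-seed x cx)
    ... | inj₁ m = ⊥-elim (ns (∈Q⇒spine m))
    ... | inj₂ (fx , z , mz , dz) = z , subst (λ b → (b ∧ D x z) ≡ true) (sym cx) dz ,
                                    λ w e → leaf-unique x fx w z (∧-true₂ {componentD r x} e) dz

    caterpillar : IsCaterpillar T H
    caterpillar = record
      { k = len Q
      ; spine = spine
      ; spine-inj = λ {a} {b} e → toℕ-injective (inj Q (toℕ a) (toℕ b) (toℕ≤pred[n] a) (toℕ≤pred[n] b) e)
      ; spine-vert = λ i → Q-in-component (toℕ i) (toℕ≤pred[n] i)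
      ; path-edge = path-edge
      ; edges-ok = edges-ok
      ; leaves = leaves-ok
      ; has-edge = s , proj₁ (has-neighbour s) , subst (λ b → (b ∧ D s (proj₁ (has-neighbour s))) ≡ true)
                     (sym (componentD-complete r s rs)) (proj₂ (has-neighbour s)) }
      where
      path-edge : ∀ (i : Fin (len Q)) → (componentD r (spine (inject₁ i)) ∧ D (spine (inject₁ i)) (spine (suc i))) ≡ true
      path-edge i rewrite toℕ-inject₁ i = subst (λ b → (b ∧ D (at Q (toℕ i)) (at Q (suc (toℕ i)))) ≡ true)
             (sym (Q-in-component (toℕ i) (≤-trans (n≤1+n _) (toℕ≤pred[n] (suc i))))) (link Q (toℕ i) (toℕ≤pred[n] (suc i)))

    -- degrees in H are D-degrees, which are odd
    oddCaterpillar : IsOddCaterpillar T H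
    oddCaterpillar = caterpillar , λ x cx _ → parity⇒Odd (count (λ y → componentD r x ∧ D x y))
                       (trans (cong parity (count-cong (λ y → cong (_∧ D x y) cx))) (D-odd x))

-- Sufficiency, step 4: one caterpillar per component of D; the components are
-- indexed by enumerating their least vertices.

module Factor {n : ℕ} (T : Graph n) (tree : IsTree T) (even : Even n) (cond : Condition T) where
  open OddEdges T tree even cond
  open Spines T tree even cond
  open ComponentCaterpillars T tree even cond
  open Walks DG

  representative : Fin n → Fin n
  representative x = fromMaybe x (first (componentD x))

  representative-linked : ∀ x → componentD x (representative x) ≡ true
  representative-linked x with first (componentD x) in e
  ... | just i = first-sound (componentD x) i e
  ... | nothing = componentD-complete x x (here refl)

  representative-cong : ∀ x y → Linked x y → representative x ≡ representative y
  representative-cong x y l with first (componentD x) in ex | first (componentD y) in ey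
  ... | just i | just j = just-injective (trans (sym ex) (trans (first-cong (componentD-cong x y l)) ey))
  ... | nothing | _ = ⊥-elim (first-complete (componentD x) x (componentD-complete x x (here refl)) ex)
  ... | just _ | nothing = ⊥-elim (first-complete (componentD y) y (componentD-complete y y (here refl)) ey)

  isRepresentative : Fin n → Bool
  isRepresentative x = representative x == x

  m : ℕ
  m = count isRepresentative

  R : Fin m → Fin n
  R = enumerate isRepresentative

  -- a seed for the spine: a non-leaf in the component of r (r or its neighbour),
  -- or r itself when the component is a single edge
  Seed : Fin n → Set
  Seed r = Σ (Fin n) λ s → Linked r s × (nonleaf s ≡ true ⊎ (∀ y → D s y ≡ true → nonleaf y ≡ false))

  seed : ∀ r → Seed r
  seed r with boolCase (nonleaf r)
  ... | inj₁ t = r , here refl , inj₁ t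
  ... | inj₂ f with has-neighbour r
  ... | t , d with boolCase (nonleaf t)
  ... | inj₁ t' = t , step (here refl) d refl , inj₁ t'
  ... | inj₂ f' = r , here refl , inj₂ (λ y dy → subst (λ z → nonleaf z ≡ false) (sym (leaf-unique r f y t dy d)) f')

  module Part (j : Fin m) = Build (R j) (proj₁ (seed (R j))) (proj₁ (proj₂ (seed (R j)))) (proj₂ (proj₂ (seed (R j))))

  covers : ∀ v → ∃[ j ] (vert (Part.H j) v ≡ true × (∀ j' → vert (Part.H j') v ≡ true → j' ≡ j))
  covers v = j , subst (λ z → componentD z v ≡ true) (sym Rj) (componentD-complete (representative v) v (reach-sym rv)) , unique
    where
    rv : Linked v (representative v)
    rv = componentD-sound v (representative v) (representative-linked v)
    isr : isRepresentative (representative v) ≡ true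
    isr = subst (λ z → (z == representative v) ≡ true) (representative-cong v (representative v) rv) (==-refl (representative v))
    j : Fin m
    j = proj₁ (enumerate-complete isRepresentative (representative v) isr)
    Rj : R j ≡ representative v
    Rj = proj₂ (enumerate-complete isRepresentative (representative v) isr)
    unique : ∀ j' → componentD (R j') v ≡ true → j' ≡ j
    unique j' c = enumerate-injective isRepresentative j' j (trans (sym (==-true (enumerate-sound isRepresentative j')))
                    (trans (representative-cong (R j') v (componentD-sound (R j') v c)) (sym Rj)))

  factor : HasOddCaterpillarFactor T
  factor = m , Part.H , Part.oddCaterpillar , covers

mainTheorem12 : (n : ℕ) (T : Graph n) → IsTree T →
    HasOddCaterpillarFactor T ⇔ (Even n × Condition T)
mainTheorem12 n T tree = mk⇔
  (λ fac → Necessity.even-order T tree fac , Necessity.condition T tree fac)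
  (λ (even , cond) → Factor.factor T tree even cond)
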